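{- Let $t\ge2$, $n\ge1$ and $z$ be integers with $0\le z\le t-2$, and let $\lambda$ be a $t$-core with $\ell(\lambda)\le tn$. Write $n_i=n_i(\lambda,tn)$. Then $\lambda$ is $z$-asymmetric if and only if \[n_i+n_{t-z-1-i}=2n\ \text{ for }0\le i\le t-z-1,\qquad\text{and}\qquad n_i=n\ \text{ for }t-z\le i\le t-1.\]
   Context: For a partition $\lambda$ with $\ell(\lambda)\le m$, $\beta(\lambda,m)=(\lambda_j+m-j)_{j=1}^m$ and $n_i(\lambda,m)$ is the number of its entries congruent to $i$ mod $t$. A $t$-core is a partition with no cell of hook length divisible by $t$. A partition $\lambda$ is $z$-asymmetric if in Frobenius coordinates $\lambda=(\alpha|\alpha+z)$: if $r$ is the rank (largest $r$ with $\lambda_r\ge r$), $\alpha_i=\lambda_i-i$ and $\lambda'_i-i=\alpha_i+z$ for $1\le i\le r$; the empty partition is $z$-asymmetric. -}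

module Defs where

open import Data.Nat using (ℕ; zero; suc; _+_; _*_; _∸_; _≤_; _<_; _≥_; NonZero; _≤?_)
open import Data.Nat.Properties using (_≟_)
open import Data.Nat.DivMod using (_%_)
open import Data.Nat.Divisibility using (_∣_)
open import Data.List using (List; []; _∷_; length; filter; map; upTo)
open import Data.List.Relation.Unary.All using (All)
open import Data.List.Relation.Unary.Linked using (Linked)
open import Relation.Nullary using (¬_; yes; no)
open import Relation.Binary.PropositionalEquality using (_≡_)

record Partition : Set where
  constructor mkPartition
  field
    parts    : List ℕ
    positive : All (λ x → 1 ≤ x) parts
    decr     : Linked _≥_ parts
open Partition public

len : Partition → ℕ
len λp = length (parts λp)

-- 1-indexed part λ_i (0 for i = 0 or i > ℓ(λ))
lookupD : List ℕ → ℕ → ℕ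
lookupD []       _             = 0
lookupD (x ∷ xs) zero          = 0
lookupD (x ∷ xs) (suc zero)    = x
lookupD (x ∷ xs) (suc (suc i)) = lookupD xs (suc i)

part : Partition → ℕ → ℕ
part λp i = lookupD (parts λp) i

conj : Partition → ℕ → ℕ
conj λp j = length (filter (λ x → j ≤? x) (parts λp))

hook : Partition → ℕ → ℕ → ℕ
hook λp i j = (part λp i ∸ j) + (conj λp j ∸ i) + 1

IsTCore : (t : ℕ) → Partition → Set
IsTCore t λp = ∀ i j → 1 ≤ i → 1 ≤ j → j ≤ part λp i → ¬ (t ∣ hook λp i j)

range1 : ℕ → List ℕ
range1 m = map suc (upTo m)

betaEntry : Partition → ℕ → ℕ → ℕ
betaEntry λp m j = part λp j + (m ∸ j)

nCount : (t : ℕ) .{{_ : NonZero t}} → Partition → ℕ → ℕ → ℕ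
nCount t λp m i = length (filter (λ j → betaEntry λp m j % t ≟ i) (range1 m))


-- rank: largest r with λ_r ≥ r (0 if none); such r satisfies r ≤ λ_r, so r ≤ ℓ(λ)
-- searching downwards from k
rankFrom : Partition → ℕ → ℕ
rankFrom λp zero    = 0
rankFrom λp (suc k) with suc k ≤? part λp (suc k)
... | yes _ = suc k
... | no  _ = rankFrom λp k

rank : Partition → ℕ
rank λp = rankFrom λp (len λp)

-- z-asymmetric: λ = (α | α + z), i.e. for 1 ≤ i ≤ r : λ'_i - i = (λ_i - i) + z
-- (both differences are nonnegative for i ≤ r)
IsZAsymmetric : ℕ → Partition → Set
IsZAsymmetric z λp =
  ∀ i → 1 ≤ i → i ≤ rank λp → conj λp i ∸ i ≡ (part λp i ∸ i) + z

-- Put m = tn and call the entries of β(λ, m) beads, the other naturals gaps. The beads ≥ m are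
-- m + (λ_i − i) for the rows i ≤ r, and the gaps < m are m − 1 − (λ′_j − j) for the columns j ≤ r,
-- so λ = (α | α + z) says exactly that x ↦ 2m − z − 1 − x exchanges the beads ≥ m with the gaps
-- < m. As λ is a t-core, the beads congruent to a mod t are a, a + t, …, a + (n_a − 1)t, since a
-- bead x above a gap x − t would give a hook of length t. The reflection sends residue a to
-- t − z − 1 − a, or for a ≥ t − z to 2t − z − 1 − a, and comparing these runners level by level
-- yields the conditions on the n_i.

module Submission where

open import Defs
open import Data.Nat
open import Data.Nat.Properties
open import Data.Nat.Divisibility using (∣-reflexive; n∣m*n)
open import Data.Nat.DivMod
  using (_%_; _/_; [m+kn]%n≡m%n; m<n⇒m%n≡m; +-distrib-/-∣ʳ; m<n⇒m/n≡0; m*n/n≡m; m≡m%n+[m/n]*n; m%n<n)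
open import Data.Nat.Tactic.RingSolver using (solve-∀)
open import Data.List using (List; []; _∷_; length; filter; map)
import Data.List.Properties as List
open import Data.List.Membership.Propositional using (_∈_; find; lose)
open import Data.List.Membership.Propositional.Properties
  using (∈-filter⁺; ∈-filter⁻; ∈-map⁺; ∈-map⁻; ∈-upTo⁺; ∈-upTo⁻)
open import Data.List.Relation.Unary.All using (All; []; _∷_)
import Data.List.Relation.Unary.All as All
import Data.List.Relation.Unary.All.Properties as Allₚ
open import Data.List.Relation.Unary.AllPairs using (AllPairs; []; _∷_)
import Data.List.Relation.Unary.AllPairs.Properties as AllPairsₚ
open import Data.List.Relation.Unary.Any using (here; there; any?)
open import Data.List.Relation.Unary.Linked using (Linked; [-]; _∷_)
import Data.List.Relation.Unary.Linked as Linked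
open import Data.Product using (∃; ∃-syntax; _×_; _,_; proj₁; proj₂)
open import Data.Sum using (inj₁; inj₂)
open import Data.Empty using (⊥; ⊥-elim)
open import Function.Bundles using (_⇔_; mk⇔; Equivalence)
open import Relation.Nullary using (¬_; Dec; yes; no)
import Relation.Nullary.Decidable as Dec
open import Relation.Binary.Definitions using (tri<; tri≈; tri>)
open import Relation.Binary.PropositionalEquality

open Equivalence using (to; from)

lookupD-≤-head : ∀ {x xs} → Linked _≥_ (x ∷ xs) → ∀ k → lookupD xs k ≤ x
lookupD-≤-head [-]        _             = z≤n
lookupD-≤-head (_   ∷ _)  zero          = z≤n
lookupD-≤-head (x≥y ∷ _)  (suc zero)    = x≥y
lookupD-≤-head (x≥y ∷ ys) (suc (suc k)) = ≤-trans (lookupD-≤-head ys (suc k)) x≥y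

lookupD-antitone : ∀ {xs} → Linked _≥_ xs → ∀ {j k} → 1 ≤ j → j ≤ k → lookupD xs k ≤ lookupD xs j
lookupD-antitone {[]}    _                                _ _         = z≤n
lookupD-antitone {_ ∷ _} _  {suc zero}    {suc zero}    _ _         = ≤-refl
lookupD-antitone {_ ∷ _} lk {suc zero}    {suc (suc k)} _ _         = lookupD-≤-head lk (suc k)
lookupD-antitone {_ ∷ _} lk {suc (suc j)} {suc (suc k)} _ (s≤s j≤k) =
  lookupD-antitone (Linked.tail lk) (s≤s z≤n) j≤k

lookupD-beyond-length : ∀ xs {k} → length xs < k → lookupD xs k ≡ 0
lookupD-beyond-length []                      _               = refl
lookupD-beyond-length (_ ∷ xs) {suc (suc k)} (s≤s ℓ<k+1) = lookupD-beyond-length xs ℓ<k+1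

countAtLeast : ℕ → List ℕ → ℕ
countAtLeast j xs = length (filter (j ≤?_) xs)

countAtLeast-accept : ∀ {j x} xs → j ≤ x → countAtLeast j (x ∷ xs) ≡ suc (countAtLeast j xs)
countAtLeast-accept {j} xs j≤x = cong length (List.filter-accept (j ≤?_) {xs = xs} j≤x)

countAtLeast-reject : ∀ {j x} xs → j ≰ x → countAtLeast j (x ∷ xs) ≡ countAtLeast j xs
countAtLeast-reject {j} xs j≰x = cong length (List.filter-reject (j ≤?_) {xs = xs} j≰x)

≤lookupD⇒≤countAtLeast : ∀ {xs} → Linked _≥_ xs → ∀ {j} k → 1 ≤ j →
                         j ≤ lookupD xs k → k ≤ countAtLeast j xs
≤lookupD⇒≤countAtLeast {[]} _ (suc k) 1≤j j≤0 = ⊥-elim (<⇒≱ 1≤j j≤0)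
≤lookupD⇒≤countAtLeast _ zero _ _ = z≤n
≤lookupD⇒≤countAtLeast {x ∷ xs} lk {j} (suc k) 1≤j j≤xₖ with j ≤? x
... | no j≰x = ⊥-elim (j≰x (≤-trans j≤xₖ (lookupD-antitone lk {1} {suc k} (s≤s z≤n) (s≤s z≤n))))
... | yes j≤x rewrite countAtLeast-accept xs j≤x with k
...   | zero   = s≤s z≤n
...   | suc k′ = s≤s (≤lookupD⇒≤countAtLeast (Linked.tail lk) (suc k′) 1≤j j≤xₖ)

≤countAtLeast⇒≤lookupD : ∀ {xs} → Linked _≥_ xs → ∀ {j} k → 1 ≤ k →
                         k ≤ countAtLeast j xs → j ≤ lookupD xs k
≤countAtLeast⇒≤lookupD {[]} _ (suc k) _ ()
≤countAtLeast⇒≤lookupD {x ∷ xs} lk {j} (suc k) _ k≤c with j ≤? x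
... | no j≰x rewrite countAtLeast-reject xs j≰x =
  ⊥-elim (j≰x (≤-trans (≤countAtLeast⇒≤lookupD (Linked.tail lk) 1 (s≤s z≤n) (≤-trans (s≤s z≤n) k≤c))
                        (lookupD-≤-head lk 1)))
... | yes j≤x rewrite countAtLeast-accept xs j≤x with k | k≤c
...   | zero   | _        = j≤x
...   | suc k′ | s≤s k′<c = ≤countAtLeast⇒≤lookupD (Linked.tail lk) (suc k′) (s≤s z≤n) k′<c

module _ (λp : Partition) where

  part-antitone : ∀ {j k} → 1 ≤ j → j ≤ k → part λp k ≤ part λp j
  part-antitone = lookupD-antitone (decr λp)

  part-beyond-len : ∀ {k} → len λp < k → part λp k ≡ 0
  part-beyond-len = lookupD-beyond-length (parts λp)

  ≤part⇒≤len : ∀ {i} → 1 ≤ i → i ≤ part λp i → i ≤ len λp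
  ≤part⇒≤len {i} 1≤i i≤λᵢ with i ≤? len λp
  ... | yes i≤ℓ = i≤ℓ
  ... | no  i≰ℓ = ⊥-elim (<⇒≱ 1≤i (subst (i ≤_) (part-beyond-len (≰⇒> i≰ℓ)) i≤λᵢ))

  ≤part⇒≤conj : ∀ {j} k → 1 ≤ j → j ≤ part λp k → k ≤ conj λp j
  ≤part⇒≤conj = ≤lookupD⇒≤countAtLeast (decr λp)

  ≤conj⇒≤part : ∀ {j} k → 1 ≤ k → k ≤ conj λp j → j ≤ part λp k
  ≤conj⇒≤part = ≤countAtLeast⇒≤lookupD (decr λp)

  conj≤len : ∀ j → conj λp j ≤ len λp
  conj≤len j = List.length-filter (j ≤?_) (parts λp)

  conj-antitone : ∀ {j j′} → 1 ≤ j → j ≤ j′ → conj λp j′ ≤ conj λp j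
  conj-antitone {j′ = j′} 1≤j j≤j′ with conj λp j′ in eq
  ... | zero  = z≤n
  ... | suc c = ≤part⇒≤conj (suc c) 1≤j (≤-trans j≤j′
                  (≤conj⇒≤part (suc c) (s≤s z≤n) (≤-reflexive (sym eq))))

  conj-unique : ∀ {j c} → 1 ≤ j →
                (∀ k → 1 ≤ k → j ≤ part λp k → k ≤ c) →
                (∀ k → 1 ≤ k → k ≤ c → j ≤ part λp k) →
                conj λp j ≡ c
  conj-unique {j} {c} 1≤j below above = ≤-antisym conj≤c (c≤conj c ≤-refl)
    where
    conj≤c : conj λp j ≤ c
    conj≤c with conj λp j in eq
    ... | zero  = z≤n
    ... | suc d = below (suc d) (s≤s z≤n) (≤conj⇒≤part (suc d) (s≤s z≤n) (≤-reflexive (sym eq)))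
    c≤conj : ∀ d → d ≤ c → d ≤ conj λp j
    c≤conj zero    _   = z≤n
    c≤conj (suc d) d≤c = ≤part⇒≤conj (suc d) 1≤j (above (suc d) (s≤s z≤n) d≤c)

  private
    rankFrom-maximal : ∀ K {i} → i ≤ K → i ≤ part λp i → i ≤ rankFrom λp K
    rankFrom-maximal zero    i≤0 _ = i≤0
    rankFrom-maximal (suc K) {i} i≤K i≤λᵢ with suc K ≤? part λp (suc K)
    ... | yes _ = i≤K
    ... | no K+1≰λ with m≤n⇒m<n∨m≡n i≤K
    ...   | inj₁ (s≤s i≤K′) = rankFrom-maximal K i≤K′ i≤λᵢ
    ...   | inj₂ refl       = ⊥-elim (K+1≰λ i≤λᵢ)

    rankFrom-≤part : ∀ K → 1 ≤ rankFrom λp K → rankFrom λp K ≤ part λp (rankFrom λp K)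
    rankFrom-≤part zero    ()
    rankFrom-≤part (suc K) 1≤r with suc K ≤? part λp (suc K)
    ... | yes K+1≤λ = K+1≤λ
    ... | no  _     = rankFrom-≤part K 1≤r

  ≤rank⇒≤part : ∀ {i} → 1 ≤ i → i ≤ rank λp → i ≤ part λp i
  ≤rank⇒≤part 1≤i i≤r =
    ≤-trans i≤r (≤-trans (rankFrom-≤part (len λp) (≤-trans 1≤i i≤r)) (part-antitone 1≤i i≤r))

  ≤part⇒≤rank : ∀ {i} → 1 ≤ i → i ≤ part λp i → i ≤ rank λp
  ≤part⇒≤rank 1≤i i≤λᵢ = rankFrom-maximal (len λp) (≤part⇒≤len 1≤i i≤λᵢ) i≤λᵢ

module _ (z : ℕ) (λp : Partition) where

  zAsym⇒conj≡part+z : IsZAsymmetric z λp → ∀ {i} → 1 ≤ i → i ≤ rank λp → conj λp i ≡ part λp i + z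
  zAsym⇒conj≡part+z zAsym {i} 1≤i i≤r = begin
    conj λp i                 ≡⟨ m∸n+n≡m i≤λ′ᵢ ⟨
    conj λp i ∸ i + i         ≡⟨ cong (_+ i) (trans (zAsym i 1≤i i≤r) (sym (+-∸-comm z i≤λᵢ))) ⟩
    part λp i + z ∸ i + i     ≡⟨ m∸n+n≡m (≤-trans i≤λᵢ (m≤m+n (part λp i) z)) ⟩
    part λp i + z             ∎
    where
    open ≡-Reasoning
    i≤λᵢ = ≤rank⇒≤part λp 1≤i i≤r
    i≤λ′ᵢ = ≤part⇒≤conj λp i 1≤i i≤λᵢ

  conj≡part+z⇒zAsym : (∀ {i} → 1 ≤ i → i ≤ rank λp → conj λp i ≡ part λp i + z) → IsZAsymmetric z λp
  conj≡part+z⇒zAsym h i 1≤i i≤r = trans (cong (_∸ i) (h 1≤i i≤r)) (+-∸-comm z (≤rank⇒≤part λp 1≤i i≤r))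

AllPairs-restrict : ∀ {a p r} {A : Set a} {P : A → Set p} {R : A → A → Set r} {xs} →
                    All P xs → AllPairs (λ x y → P x → P y → R x y) xs → AllPairs R xs
AllPairs-restrict []         []         = []
AllPairs-restrict (px ∷ pxs) (rx ∷ rxs) =
  All.zipWith (λ (py , r) → r px py) (pxs , rx) ∷ AllPairs-restrict pxs rxs

DownClosed : List ℕ → Set
DownClosed ks = ∀ {k} → suc k ∈ ks → k ∈ ks

∈⇔<length : ∀ {ks} → AllPairs _>_ ks → DownClosed ks → ∀ k → k ∈ ks ⇔ k < length ks
∈⇔<length {[]}        _                  _      _ = mk⇔ (λ ()) (λ ())
∈⇔<length {k₀ ∷ rest} (rest<k₀ ∷ sorted) closed k = mk⇔ (⇒ k) (⇐ k)
  where
  ∈-tail : ∀ {k} → k < k₀ → k ∈ k₀ ∷ rest → k ∈ rest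
  ∈-tail k<k₀ (here refl) = ⊥-elim (<-irrefl refl k<k₀)
  ∈-tail _    (there k∈)  = k∈

  IH : ∀ k → k ∈ rest ⇔ k < length rest
  IH = ∈⇔<length sorted λ k+1∈ →
         ∈-tail (<-trans (n<1+n _) (All.lookup rest<k₀ k+1∈)) (closed (there k+1∈))

  k₀≡length : k₀ ≡ length rest
  k₀≡length = ≤-antisym (k₀≤ k₀ refl) (≤k₀ (length rest) ≤-refl)
    where
    k₀≤ : ∀ k → k ≡ k₀ → k ≤ length rest
    k₀≤ zero    _  = z≤n
    k₀≤ (suc k) eq = to (IH k) (∈-tail (≤-reflexive eq) (closed (here eq)))
    ≤k₀ : ∀ l → l ≤ length rest → l ≤ k₀
    ≤k₀ zero    _   = z≤n
    ≤k₀ (suc l) l<ℓ = All.lookup rest<k₀ (from (IH l) l<ℓ)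

  ⇒ : ∀ k → k ∈ k₀ ∷ rest → k < suc (length rest)
  ⇒ k (here refl) = s≤s (≤-reflexive k₀≡length)
  ⇒ k (there k∈)  = m<n⇒m<1+n (to (IH k) k∈)

  ⇐ : ∀ k → k < suc (length rest) → k ∈ k₀ ∷ rest
  ⇐ k (s≤s k≤ℓ) with m≤n⇒m<n∨m≡n k≤ℓ
  ... | inj₁ k<ℓ = there (from (IH k) k<ℓ)
  ... | inj₂ refl = here (sym k₀≡length)

module _ {ℓ} (R : ℕ → ℕ → Set ℓ) (r : ℕ)
         (total : ∀ {i} → 1 ≤ i → i ≤ r → ∃ (R i))
         (into : ∀ {i j} → R i j → 1 ≤ j × j ≤ r)
         (increasing : ∀ {i i′ j j′} → 1 ≤ i → i < i′ → i′ ≤ r → R i j → R i′ j′ → j < j′)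
         where

  private
    ≤related : ∀ i → 1 ≤ i → i ≤ r → ∀ {j} → R i j → i ≤ j
    ≤related (suc zero)    _ _   Rij = proj₁ (into Rij)
    ≤related (suc (suc i)) _ i+2≤r Rij =
      ≤-trans (s≤s (≤related (suc i) (s≤s z≤n) (<⇒≤ i+2≤r) Rij′)) (increasing (s≤s z≤n) ≤-refl i+2≤r Rij′ Rij)
      where
      Rij′ : R (suc i) (proj₁ (total (s≤s z≤n) (<⇒≤ i+2≤r)))
      Rij′ = proj₂ (total (s≤s z≤n) (<⇒≤ i+2≤r))

    related≤ : ∀ d i → i + d ≡ r → 1 ≤ i → ∀ {j} → R i j → j ≤ i
    related≤ zero    i i+0≡r _   Rij = subst (_ ≤_) (trans (sym i+0≡r) (+-identityʳ i)) (proj₂ (into Rij))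
    related≤ (suc d) i i+d+1≡r 1≤i {j} Rij = ≤-pred (≤-trans (increasing 1≤i ≤-refl i+1≤r Rij Rij′)
                                                       (related≤ d (suc i) i+1+d≡r (s≤s z≤n) Rij′))
      where
      i+1+d≡r : suc i + d ≡ r
      i+1+d≡r = trans (sym (+-suc i d)) i+d+1≡r
      i+1≤r : suc i ≤ r
      i+1≤r = subst (suc i ≤_) i+1+d≡r (m≤m+n (suc i) d)
      Rij′ : R (suc i) (proj₁ (total (s≤s z≤n) i+1≤r))
      Rij′ = proj₂ (total (s≤s z≤n) i+1≤r)

  increasingSelfCorrespondence-diagonal : ∀ {i j} → 1 ≤ i → i ≤ r → R i j → j ≡ i
  increasingSelfCorrespondence-diagonal {i} 1≤i i≤r Rij =
    ≤-antisym (related≤ (r ∸ i) i (m+[n∸m]≡n i≤r) 1≤i Rij) (≤related i 1≤i i≤r Rij)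

range1-bounds : ∀ {m j} → j ∈ range1 m → 1 ≤ j × j ≤ m
range1-bounds j∈ with ∈-map⁻ suc j∈
... | _ , i∈ , refl = s≤s z≤n , ∈-upTo⁻ i∈

range1-complete : ∀ {m j} → 1 ≤ j → j ≤ m → j ∈ range1 m
range1-complete {j = suc i} _ i<m = ∈-map⁺ suc (∈-upTo⁺ i<m)

module _ (t : ℕ) .{{_ : NonZero t}} where

  [a+kt]%t≡a : ∀ {a} k → a < t → (a + k * t) % t ≡ a
  [a+kt]%t≡a {a} k a<t = trans ([m+kn]%n≡m%n a k t) (m<n⇒m%n≡m a<t)

  [a+kt]/t≡k : ∀ {a} k → a < t → (a + k * t) / t ≡ k
  [a+kt]/t≡k {a} k a<t = begin
    (a + k * t) / t    ≡⟨ +-distrib-/-∣ʳ a (n∣m*n k) ⟩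
    a / t + k * t / t  ≡⟨ cong₂ _+_ (m<n⇒m/n≡0 a<t) (m*n/n≡m k t) ⟩
    k                  ∎
    where open ≡-Reasoning

  /-monoˡ-<-sameResidue : ∀ {x y} → x % t ≡ y % t → y < x → y / t < x / t
  /-monoˡ-<-sameResidue {x} {y} x%t≡y%t y<x =
    *-cancelʳ-< t (y / t) (x / t) (+-cancelˡ-< (x % t) _ _ (begin-strict
    x % t + y / t * t   ≡⟨ cong (_+ y / t * t) x%t≡y%t ⟩
    y % t + y / t * t   ≡⟨ m≡m%n+[m/n]*n y t ⟨
    y                   <⟨ y<x ⟩
    x                   ≡⟨ m≡m%n+[m/n]*n x t ⟩
    x % t + x / t * t   ∎))
    where open ≤-Reasoning

module BetaSet (λp : Partition) (m : ℕ) (ℓ≤m : len λp ≤ m) where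

  β : ℕ → ℕ
  β = betaEntry λp m

  β+index : ∀ {k} → k ≤ m → β k + k ≡ part λp k + m
  β+index {k} k≤m = trans (+-assoc (part λp k) (m ∸ k) k) (cong (part λp k +_) (m∸n+n≡m k≤m))

  β-strictlyDecreasing : ∀ {j k} → 1 ≤ j → j < k → k ≤ m → β k < β j
  β-strictlyDecreasing {j} {k} 1≤j j<k k≤m = +-cancelʳ-< k (β k) (β j) (begin-strict
    β k + k           ≡⟨ β+index k≤m ⟩
    part λp k + m     ≤⟨ +-monoˡ-≤ m (part-antitone λp 1≤j (<⇒≤ j<k)) ⟩
    part λp j + m     ≡⟨ β+index (≤-trans (<⇒≤ j<k) k≤m) ⟨
    β j + j           <⟨ +-monoʳ-< (β j) j<k ⟩
    β j + k           ∎)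
    where open ≤-Reasoning

  InBeta : ℕ → Set
  InBeta x = ∃[ k ] 1 ≤ k × k ≤ m × β k ≡ x

  inBeta? : ∀ x → Dec (InBeta x)
  inBeta? x = Dec.map′ fromAny toAny (any? (λ k → β k ≟ x) (range1 m))
    where
    fromAny = λ a → let k , k∈ , βk≡x = find a ; 1≤k , k≤m = range1-bounds k∈ in k , 1≤k , k≤m , βk≡x
    toAny = λ (k , 1≤k , k≤m , βk≡x) → lose (range1-complete 1≤k k≤m) βk≡x

  -- y = m + j − 1 − λ′ⱼ, the gap of the β-set at the foot of column j.
  IsColumnGap : ℕ → ℕ → Set
  IsColumnGap j y = y + suc (conj λp j) ≡ m + j

  record Gap (y : ℕ) : Set where
    field
      above     : ℕ
      above≤m   : above ≤ m
      y<β-above : ∀ {k} → 1 ≤ k → k ≤ above → y < β k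
      β<y-below : ∀ {k} → above < k → k ≤ m → β k < y

  private
    gapUpTo : ∀ {y} → ¬ InBeta y → ∀ N → N ≤ m →
              ∃[ c ] c ≤ N × (∀ {k} → 1 ≤ k → k ≤ c → y < β k) × (c < N → β (suc c) < y)
    gapUpTo y∉ zero _ = 0 , z≤n , (λ 1≤k k≤0 → ⊥-elim (<⇒≱ 1≤k k≤0)) , λ ()
    gapUpTo {y} y∉ (suc N) N<m with gapUpTo y∉ N (<⇒≤ N<m)
    ... | c , c≤N , y<β , βc+1<y with m≤n⇒m<n∨m≡n c≤N
    ...   | inj₁ c<N  = c , m≤n⇒m≤1+n c≤N , y<β , λ _ → βc+1<y c<N
    ...   | inj₂ refl with <-cmp y (β (suc c))
    ...     | tri< y<βc+1 _ _ = suc c , ≤-refl , y<β′ , λ c+1<c+1 → ⊥-elim (<-irrefl refl c+1<c+1)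
      where
      y<β′ : ∀ {k} → 1 ≤ k → k ≤ suc c → y < β k
      y<β′ 1≤k k≤c+1 with m≤n⇒m<n∨m≡n k≤c+1
      ... | inj₁ (s≤s k≤c) = y<β 1≤k k≤c
      ... | inj₂ refl      = y<βc+1
    ...     | tri≈ _ y≡βc+1 _ = ⊥-elim (y∉ (suc c , s≤s z≤n , N<m , sym y≡βc+1))
    ...     | tri> _ _ βc+1<y = c , n≤1+n c , y<β , λ _ → βc+1<y

  gap : ∀ {y} → ¬ InBeta y → Gap y
  gap y∉ with gapUpTo y∉ m ≤-refl
  ... | c , c≤m , y<β , βc+1<y = record
    { above     = c
    ; above≤m   = c≤m
    ; y<β-above = y<β
    ; β<y-below = λ c<k k≤m →
        ≤-<-trans (β-antitone (s≤s z≤n) c<k k≤m) (βc+1<y (<-≤-trans c<k k≤m))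
    }
    where
    β-antitone : ∀ {j k} → 1 ≤ j → j ≤ k → k ≤ m → β k ≤ β j
    β-antitone 1≤j j≤k k≤m with m≤n⇒m<n∨m≡n j≤k
    ... | inj₁ j<k  = <⇒≤ (β-strictlyDecreasing 1≤j j<k k≤m)
    ... | inj₂ refl = ≤-refl

  module _ {y} (g : Gap y) where
    open Gap g

    -- Solving IsColumnGap j y for j, knowing λ′ⱼ = above (conj-column).
    column : ℕ
    column = y + 1 + above ∸ m

    m≤y+above : m ≤ y + above
    m≤y+above with m≤n⇒m<n∨m≡n above≤m
    ... | inj₂ refl = m≤n+m m y
    ... | inj₁ c<m  = begin
      m                            ≤⟨ m≤n+m m (part λp (suc above)) ⟩
      part λp (suc above) + m      ≡⟨ β+index c<m ⟨
      β (suc above) + suc above    ≡⟨ +-suc (β (suc above)) above ⟩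
      suc (β (suc above)) + above  ≤⟨ +-monoˡ-≤ above (β<y-below ≤-refl c<m) ⟩
      y + above                    ∎
      where open ≤-Reasoning

    column+m : column + m ≡ y + 1 + above
    column+m = m∸n+n≡m (≤-trans m≤y+above (+-monoˡ-≤ above (m≤m+n y 1)))

    column≤part : ∀ {k} → 1 ≤ k → k ≤ above → column ≤ part λp k
    column≤part {k} 1≤k k≤c = +-cancelʳ-≤ m column (part λp k) (begin
      column + m            ≡⟨ column+m ⟩
      y + 1 + above         ≡⟨ cong (_+ above) (+-comm y 1) ⟩
      suc y + above         ≤⟨ +-monoˡ-≤ above (y<β-above (≤-trans 1≤k k≤c) ≤-refl) ⟩
      β above + above       ≡⟨ β+index above≤m ⟩
      part λp above + m     ≤⟨ +-monoˡ-≤ m (part-antitone λp 1≤k k≤c) ⟩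
      part λp k + m         ∎)
      where open ≤-Reasoning

    1≤column : 1 ≤ column
    1≤column = +-cancelʳ-≤ m 1 column (begin
      suc m                ≤⟨ s≤s m≤y+above ⟩
      suc (y + above)      ≡⟨ cong (_+ above) (+-comm 1 y) ⟩
      y + 1 + above        ≡⟨ column+m ⟨
      column + m           ∎)
      where open ≤-Reasoning

    conj-column : conj λp column ≡ above
    conj-column = conj-unique λp 1≤column ≤above (λ _ → column≤part)
      where
      ≤above : ∀ k → 1 ≤ k → column ≤ part λp k → k ≤ above
      ≤above k 1≤k j≤λₖ with k ≤? above
      ... | yes k≤c = k≤c
      ... | no  k≰c with m≤n⇒m<n∨m≡n above≤m
      ...   | inj₂ refl = ⊥-elim (<⇒≱ 1≤column
                (subst (column ≤_) (part-beyond-len λp (≤-<-trans ℓ≤m (≰⇒> k≰c))) j≤λₖ))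
      ...   | inj₁ c<m  = ⊥-elim (<⇒≱ λc+1<column
                (≤-trans j≤λₖ (part-antitone λp (s≤s z≤n) (≰⇒> k≰c))))
        where
        λc+1<column : part λp (suc above) < column
        λc+1<column = +-cancelʳ-< m (part λp (suc above)) column (begin-strict
          part λp (suc above) + m   ≡⟨ β+index c<m ⟨
          β (suc above) + suc above <⟨ +-monoˡ-< (suc above) (β<y-below ≤-refl c<m) ⟩
          y + suc above             ≡⟨ +-assoc y 1 above ⟨
          y + 1 + above             ≡⟨ column+m ⟨
          column + m                ∎)
          where open ≤-Reasoning

    gap-isColumnGap : IsColumnGap column y
    gap-isColumnGap = begin
      y + suc (conj λp column) ≡⟨ cong (λ c → y + suc c) conj-column ⟩
      y + suc above            ≡⟨ +-assoc y 1 above ⟨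
      y + 1 + above            ≡⟨ column+m ⟨
      column + m               ≡⟨ +-comm column m ⟩
      m + column               ∎
      where open ≡-Reasoning

    hook-column : ∀ {i} → 1 ≤ i → i ≤ above → hook λp i column + y ≡ β i
    hook-column {i} 1≤i i≤c = +-cancelʳ-≡ (i + (column + m)) _ _ (begin
      hook λp i column + y + (i + (column + m))
        ≡⟨ cong (λ c → (part λp i ∸ column) + (c ∸ i) + 1 + y + (i + (column + m))) conj-column ⟩
      (part λp i ∸ column) + (above ∸ i) + 1 + y + (i + (column + m))
        ≡⟨ regroup (part λp i ∸ column) (above ∸ i) i column y m ⟩
      (part λp i ∸ column + column) + (above ∸ i + i) + 1 + y + m
        ≡⟨ cong₂ (λ a b → a + b + 1 + y + m) (m∸n+n≡m (column≤part 1≤i i≤c)) (m∸n+n≡m i≤c) ⟩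
      part λp i + above + 1 + y + m
        ≡⟨ regroup′ (part λp i) above y m ⟩
      part λp i + m + (y + 1 + above)
        ≡⟨ cong₂ _+_ (β+index (≤-trans i≤c above≤m)) column+m ⟨
      β i + i + (column + m)
        ≡⟨ +-assoc (β i) i (column + m) ⟩
      β i + (i + (column + m)) ∎)
      where
      open ≡-Reasoning
      regroup : ∀ a b i j y m → a + b + 1 + y + (i + (j + m)) ≡ (a + j) + (b + i) + 1 + y + m
      regroup = solve-∀
      regroup′ : ∀ l c y m → l + c + 1 + y + m ≡ l + m + (y + 1 + c)
      regroup′ = solve-∀

  inBeta-∸ : ∀ {t x} → IsTCore t λp → InBeta x → t ≤ x → InBeta (x ∸ t)
  inBeta-∸ {t} {x} core (i , 1≤i , i≤m , βi≡x) t≤x with inBeta? (x ∸ t)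
  ... | yes x∸t∈β = x∸t∈β
  ... | no  x∸t∉β =
    ⊥-elim (core i (column g) 1≤i (1≤column g) (column≤part g 1≤i i≤c) (∣-reflexive (sym hook≡t)))
    where
    g = gap x∸t∉β
    open Gap g
    i≤c : i ≤ above
    i≤c with i ≤? above
    ... | yes i≤c = i≤c
    ... | no  i≰c = ⊥-elim (<⇒≱ (β<y-below (≰⇒> i≰c) i≤m) (subst (x ∸ t ≤_) (sym βi≡x) (m∸n≤m x t)))
    hook≡t : hook λp i (column g) ≡ t
    hook≡t = +-cancelʳ-≡ (x ∸ t) _ _ (begin
      hook λp i (column g) + (x ∸ t) ≡⟨ hook-column g 1≤i i≤c ⟩
      β i                           ≡⟨ βi≡x ⟩
      x                             ≡⟨ m∸n+n≡m t≤x ⟨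
      x ∸ t + t                     ≡⟨ +-comm (x ∸ t) t ⟩
      t + (x ∸ t)                   ∎)
      where open ≡-Reasoning

  module _ (t : ℕ) .{{_ : NonZero t}} (core : IsTCore t λp) {a} (a<t : a < t) where
    private
      residue? = λ j → β j % t ≟ a

      levels : List ℕ
      levels = map (λ j → β j / t) (filter residue? (range1 m))

      levels-decreasing : AllPairs _>_ levels
      levels-decreasing = AllPairsₚ.map⁺ (AllPairs-restrict (Allₚ.all-filter residue? (range1 m))
        (AllPairsₚ.filter⁺ residue? (AllPairsₚ.map⁺ (AllPairsₚ.applyUpTo⁺₁ _ m λ i<j j<m βi%t≡a βj%t≡a →
          /-monoˡ-<-sameResidue t (trans βi%t≡a (sym βj%t≡a)) (β-strictlyDecreasing (s≤s z≤n) (s≤s i<j) j<m)))))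

      ∈levels⇔ : ∀ k → k ∈ levels ⇔ InBeta (a + k * t)
      ∈levels⇔ k = mk⇔ ⇒ ⇐
        where
        ⇒ : k ∈ levels → InBeta (a + k * t)
        ⇒ k∈ with ∈-map⁻ (λ j → β j / t) k∈
        ... | j , j∈ , refl with ∈-filter⁻ residue? j∈
        ...   | j∈range , βj%t≡a = let 1≤j , j≤m = range1-bounds j∈range in
          j , 1≤j , j≤m , trans (m≡m%n+[m/n]*n (β j) t) (cong (_+ β j / t * t) βj%t≡a)
        ⇐ : InBeta (a + k * t) → k ∈ levels
        ⇐ (j , 1≤j , j≤m , βj≡) = subst (_∈ levels) (trans (cong (_/ t) βj≡) ([a+kt]/t≡k t k a<t))
          (∈-map⁺ (λ j → β j / t) (∈-filter⁺ residue? (range1-complete 1≤j j≤m)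
            (trans (cong (_% t) βj≡) ([a+kt]%t≡a t k a<t))))

      levels-downClosed : DownClosed levels
      levels-downClosed {k} k+1∈ = from (∈levels⇔ k)
        (subst InBeta a+kt+t∸t≡a+kt (inBeta-∸ core (to (∈levels⇔ (suc k)) k+1∈) t≤a+kt+t))
        where
        t≤a+kt+t : t ≤ a + suc k * t
        t≤a+kt+t = ≤-trans (m≤m+n t (k * t)) (m≤n+m _ a)
        a+kt+t∸t≡a+kt : a + suc k * t ∸ t ≡ a + k * t
        a+kt+t∸t≡a+kt = trans (cong (_∸ t) (+-comm a (t + k * t)))
          (trans (cong (_∸ t) (+-assoc t (k * t) a)) (trans (m+n∸m≡n t (k * t + a)) (+-comm (k * t) a)))

    inBeta⇔<nCount : ∀ k → InBeta (a + k * t) ⇔ k < nCount t λp m a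
    inBeta⇔<nCount k = mk⇔
      (λ k∈β → subst (k <_) length-levels (to (∈⇔<length levels-decreasing levels-downClosed k)
                 (from (∈levels⇔ k) k∈β)))
      (λ k<N → to (∈levels⇔ k) (from (∈⇔<length levels-decreasing levels-downClosed k)
                 (subst (k <_) (sym length-levels) k<N)))
      where
      length-levels : length levels ≡ nCount t λp m a
      length-levels = List.length-map _ (filter residue? (range1 m))

  m≤β⇒≤rank : ∀ {i} → 1 ≤ i → i ≤ m → m ≤ β i → i ≤ rank λp
  m≤β⇒≤rank {i} 1≤i i≤m m≤βᵢ = ≤part⇒≤rank λp 1≤i (+-cancelˡ-≤ m i (part λp i) (begin
    m + i          ≤⟨ +-monoˡ-≤ i m≤βᵢ ⟩
    β i + i        ≡⟨ β+index i≤m ⟩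
    part λp i + m  ≡⟨ +-comm (part λp i) m ⟩
    m + part λp i  ∎))
    where open ≤-Reasoning

  ≤rank⇒m≤β : ∀ {i} → 1 ≤ i → i ≤ rank λp → i ≤ m × m ≤ β i
  ≤rank⇒m≤β {i} 1≤i i≤r = i≤m , +-cancelʳ-≤ i m (β i) (begin
    m + i          ≤⟨ +-monoʳ-≤ m i≤λᵢ ⟩
    m + part λp i  ≡⟨ +-comm m (part λp i) ⟩
    part λp i + m  ≡⟨ β+index i≤m ⟨
    β i + i        ∎)
    where
    open ≤-Reasoning
    i≤λᵢ = ≤rank⇒≤part λp 1≤i i≤r
    i≤m = ≤-trans (≤part⇒≤len λp 1≤i i≤λᵢ) ℓ≤m

  columnGap∉β : ∀ {j y} → 1 ≤ j → IsColumnGap j y → ¬ InBeta y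
  columnGap∉β {j} {y} 1≤j y+λ′ⱼ+1≡m+j (k , 1≤k , k≤m , βk≡y) with k ≤? conj λp j
  ... | yes k≤λ′ⱼ = <-irrefl (sym βk≡y) (+-cancelʳ-< k y (β k) (begin-strict
    y + k               <⟨ +-monoʳ-< y (s≤s k≤λ′ⱼ) ⟩
    y + suc (conj λp j) ≡⟨ y+λ′ⱼ+1≡m+j ⟩
    m + j               ≤⟨ +-monoʳ-≤ m (≤conj⇒≤part λp k 1≤k k≤λ′ⱼ) ⟩
    m + part λp k       ≡⟨ +-comm m (part λp k) ⟩
    part λp k + m       ≡⟨ β+index k≤m ⟨
    β k + k             ∎))
    where open ≤-Reasoning
  ... | no k≰λ′ⱼ = <-irrefl βk≡y (+-cancelʳ-< k (β k) y (begin-strict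
    β k + k             ≡⟨ β+index k≤m ⟩
    part λp k + m       ≡⟨ +-comm (part λp k) m ⟩
    m + part λp k       <⟨ +-monoʳ-< m λₖ<j ⟩
    m + j               ≡⟨ y+λ′ⱼ+1≡m+j ⟨
    y + suc (conj λp j) ≤⟨ +-monoʳ-≤ y (≰⇒> k≰λ′ⱼ) ⟩
    y + k               ∎))
    where
    open ≤-Reasoning
    λₖ<j : part λp k < j
    λₖ<j with j ≤? part λp k
    ... | yes j≤λₖ = ⊥-elim (k≰λ′ⱼ (≤part⇒≤conj λp k 1≤j j≤λₖ))
    ... | no  j≰λₖ = ≰⇒> j≰λₖ

  columnGap-increasing : ∀ {y y′ j j′} → 1 ≤ j′ → IsColumnGap j y → IsColumnGap j′ y′ → y < y′ → j < j′
  columnGap-increasing {y} {y′} {j} {j′} 1≤j′ gapⱼ gapⱼ′ y<y′ with j′ ≤? j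
  ... | no  j′≰j = ≰⇒> j′≰j
  ... | yes j′≤j = ⊥-elim (<⇒≱ y<y′ (+-cancelʳ-≤ (suc (conj λp j′)) y′ y (begin
    y′ + suc (conj λp j′) ≡⟨ gapⱼ′ ⟩
    m + j′                ≤⟨ +-monoʳ-≤ m j′≤j ⟩
    m + j                 ≡⟨ gapⱼ ⟨
    y + suc (conj λp j)   ≤⟨ +-monoʳ-≤ y (s≤s (conj-antitone λp 1≤j′ j′≤j)) ⟩
    y + suc (conj λp j′)  ∎)))
    where open ≤-Reasoning

  module _ {y} (g : Gap y) (y<m : y < m) where
    open Gap g

    column≤above : column g ≤ above
    column≤above = +-cancelʳ-≤ m (column g) above (begin
      column g + m   ≡⟨ column+m g ⟩
      y + 1 + above  ≤⟨ +-monoˡ-≤ above (subst (_≤ m) (+-comm 1 y) y<m) ⟩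
      m + above      ≡⟨ +-comm m above ⟩
      above + m      ∎)
      where open ≤-Reasoning

    column≤rank : column g ≤ rank λp
    column≤rank = ≤part⇒≤rank λp (1≤column g) (column≤part g (1≤column g) column≤above)

module Reflection (λp : Partition) (m : ℕ) (ℓ≤m : len λp ≤ m) (z : ℕ) (z≤m : z ≤ m) where
  open BetaSet λp m ℓ≤m

  record Reflective : Set where
    field
      noBeadPair : ∀ {x y} → x + y + suc z ≡ m + m → m ≤ x → InBeta x → InBeta y → ⊥
      noGapPair  : ∀ {x y} → x + y + suc z ≡ m + m → m ≤ x → ¬ InBeta x → ¬ InBeta y → ⊥
      noHighBead : ∀ {x} → m + m ≤ x + z → InBeta x → ⊥
      noLowGap   : ∀ {y} → m ≤ y + z → y < m → ¬ InBeta y → ⊥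

  -- For x = β i (so l = λᵢ) and λ′ᵢ = λᵢ + z, the right-hand side says IsColumnGap i y.
  reflection⇔columnGap : ∀ {x y i l} → x + i ≡ l + m → x + y + suc z ≡ m + m ⇔ y + suc (l + z) ≡ m + i
  reflection⇔columnGap {x} {y} {i} {l} x+i≡l+m = mk⇔
    (λ reflected → +-cancelʳ-≡ m _ _ (begin
      y + suc (l + z) + m ≡⟨ shift ⟨
      x + y + suc z + i   ≡⟨ cong (_+ i) reflected ⟩
      m + m + i           ≡⟨ +-assoc m m i ⟩
      m + (m + i)         ≡⟨ +-comm m (m + i) ⟩
      m + i + m           ∎))
    (λ column-gap → +-cancelʳ-≡ i _ _ (begin
      x + y + suc z + i   ≡⟨ shift ⟩
      y + suc (l + z) + m ≡⟨ cong (_+ m) column-gap ⟩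
      m + i + m           ≡⟨ +-comm (m + i) m ⟩
      m + (m + i)         ≡⟨ +-assoc m m i ⟨
      m + m + i           ∎))
    where
    open ≡-Reasoning
    shift : x + y + suc z + i ≡ y + suc (l + z) + m
    shift = begin
      x + y + suc z + i   ≡⟨ lhs x y z i ⟩
      (x + i) + y + suc z ≡⟨ cong (λ u → u + y + suc z) x+i≡l+m ⟩
      (l + m) + y + suc z ≡⟨ rhs l m y z ⟩
      y + suc (l + z) + m ∎
      where
      lhs : ∀ x y z i → x + y + suc z + i ≡ (x + i) + y + suc z
      lhs = solve-∀
      rhs : ∀ l m y z → (l + m) + y + suc z ≡ y + suc (l + z) + m
      rhs = solve-∀

  reflection<m : ∀ {x y} → x + y + suc z ≡ m + m → m ≤ x → y < m
  reflection<m {x} {y} reflected m≤x = +-cancelˡ-< m y m (begin-strict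
    m + y            <⟨ +-monoʳ-< m (m<m+n y (s≤s z≤n)) ⟩
    m + (y + suc z)  ≤⟨ +-monoˡ-≤ (y + suc z) m≤x ⟩
    x + (y + suc z)  ≡⟨ +-assoc x y (suc z) ⟨
    x + y + suc z    ≡⟨ reflected ⟩
    m + m            ∎)
    where open ≤-Reasoning

  module _ (zAsym : IsZAsymmetric z λp) where
    private
      conj≡part+z = zAsym⇒conj≡part+z z λp zAsym

      bead-row : ∀ {x} → InBeta x → m ≤ x → ∃[ i ] 1 ≤ i × i ≤ m × β i ≡ x × i ≤ rank λp
      bead-row (i , 1≤i , i≤m , βi≡x) m≤x =
        i , 1≤i , i≤m , βi≡x , m≤β⇒≤rank 1≤i i≤m (subst (m ≤_) (sym βi≡x) m≤x)

      gapColumn-λ′≡λ+z : ∀ {y} (g : Gap y) → y < m → conj λp (column g) ≡ part λp (column g) + z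
      gapColumn-λ′≡λ+z g y<m = conj≡part+z (1≤column g) (column≤rank g y<m)

    zAsym⇒noBeadPair : ∀ {x y} → x + y + suc z ≡ m + m → m ≤ x → InBeta x → InBeta y → ⊥
    zAsym⇒noBeadPair reflected m≤x x∈β y∈β with bead-row x∈β m≤x
    ... | i , 1≤i , i≤m , refl , i≤r = columnGap∉β 1≤i
      (subst (λ c → _ + suc c ≡ m + i) (sym (conj≡part+z 1≤i i≤r))
        (to (reflection⇔columnGap (β+index i≤m)) reflected)) y∈β

    zAsym⇒noGapPair : ∀ {x y} → x + y + suc z ≡ m + m → m ≤ x → ¬ InBeta x → ¬ InBeta y → ⊥
    zAsym⇒noGapPair {x} {y} reflected m≤x x∉β y∉β = x∉β (j , 1≤column g , j≤m , βj≡x)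
      where
      g = gap y∉β
      j = column g
      y<m = reflection<m reflected m≤x
      j≤m : j ≤ m
      j≤m = ≤-trans (column≤above g y<m) (Gap.above≤m g)
      columnGap : y + suc (part λp j + z) ≡ m + j
      columnGap = subst (λ c → y + suc c ≡ m + j) (gapColumn-λ′≡λ+z g y<m) (gap-isColumnGap g)
      βj≡x : β j ≡ x
      βj≡x = +-cancelʳ-≡ (y + suc z) _ _ (begin
        β j + (y + suc z)   ≡⟨ +-assoc (β j) y (suc z) ⟨
        β j + y + suc z     ≡⟨ from (reflection⇔columnGap (β+index j≤m)) columnGap ⟩
        m + m               ≡⟨ reflected ⟨
        x + y + suc z       ≡⟨ +-assoc x y (suc z) ⟩
        x + (y + suc z)     ∎)
        where open ≡-Reasoning

    zAsym⇒noHighBead : ∀ {x} → m + m ≤ x + z → InBeta x → ⊥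
    zAsym⇒noHighBead {x} 2m≤x+z x∈β with bead-row x∈β (+-cancelʳ-≤ z m x (≤-trans (+-monoʳ-≤ m z≤m) 2m≤x+z))
    ... | i , 1≤i , i≤m , refl , i≤r = <-irrefl refl (<-≤-trans (m<m+n (β i + z) 1≤i) (begin
      β i + z + i           ≡⟨ swap (β i) z i ⟩
      β i + i + z           ≡⟨ cong (_+ z) (β+index i≤m) ⟩
      part λp i + m + z     ≡⟨ swap (part λp i) m z ⟩
      part λp i + z + m     ≡⟨ cong (_+ m) (conj≡part+z 1≤i i≤r) ⟨
      conj λp i + m         ≤⟨ +-monoˡ-≤ m (≤-trans (conj≤len λp i) ℓ≤m) ⟩
      m + m                 ≤⟨ 2m≤x+z ⟩
      β i + z               ∎))
      where
      open ≤-Reasoning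
      swap : ∀ a b c → a + b + c ≡ a + c + b
      swap = solve-∀

    zAsym⇒noLowGap : ∀ {y} → m ≤ y + z → y < m → ¬ InBeta y → ⊥
    zAsym⇒noLowGap {y} m≤y+z y<m y∉β = <⇒≱ λⱼ<j (column≤part g (1≤column g) (column≤above g y<m))
      where
      g = gap y∉β
      j = column g
      λⱼ<j : part λp j < j
      λⱼ<j = +-cancelʳ-< m _ _ (begin-strict
        part λp j + m             ≤⟨ +-monoʳ-≤ (part λp j) m≤y+z ⟩
        part λp j + (y + z)       <⟨ n<1+n _ ⟩
        suc (part λp j + (y + z)) ≡⟨ regroup y (part λp j) z ⟩
        y + suc (part λp j + z)   ≡⟨ cong (λ c → y + suc c) (gapColumn-λ′≡λ+z g y<m) ⟨
        y + suc (conj λp j)       ≡⟨ gap-isColumnGap g ⟩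
        m + j                     ≡⟨ +-comm m j ⟩
        j + m                     ∎)
        where
        open ≤-Reasoning
        regroup : ∀ y l z → suc (l + (y + z)) ≡ y + suc (l + z)
        regroup = solve-∀

    zAsym⇒reflective : Reflective
    zAsym⇒reflective = record
      { noBeadPair = zAsym⇒noBeadPair
      ; noGapPair  = zAsym⇒noGapPair
      ; noHighBead = zAsym⇒noHighBead
      ; noLowGap   = zAsym⇒noLowGap
      }

  reflective⇒zAsym : Reflective → IsZAsymmetric z λp
  reflective⇒zAsym reflective = conj≡part+z⇒zAsym z λp conj≡part+z
    where
    open Reflective reflective
    r = rank λp

    reflectionOf : ℕ → ℕ
    reflectionOf i = m + m ∸ (β i + suc z)

    module Row {i} (1≤i : 1 ≤ i) (i≤r : i ≤ r) where
      i≤m = proj₁ (≤rank⇒m≤β 1≤i i≤r)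
      m≤βᵢ = proj₂ (≤rank⇒m≤β 1≤i i≤r)

      reflected : β i + reflectionOf i + suc z ≡ m + m
      reflected with m + m ≤? β i + z
      ... | yes 2m≤βᵢ+z = ⊥-elim (noHighBead 2m≤βᵢ+z (i , 1≤i , i≤m , refl))
      ... | no  2m≰βᵢ+z = trans (swap (β i) (reflectionOf i) (suc z))
                              (m∸n+n≡m (subst (_≤ m + m) (sym (+-suc (β i) z)) (≰⇒> 2m≰βᵢ+z)))
        where
        swap : ∀ a b c → a + b + c ≡ b + (a + c)
        swap = solve-∀

      reflection∉β : ¬ InBeta (reflectionOf i)
      reflection∉β = noBeadPair reflected m≤βᵢ (i , 1≤i , i≤m , refl)

      reflectionOf<m : reflectionOf i < m
      reflectionOf<m = reflection<m reflected m≤βᵢ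

    ReflectsTo : ℕ → ℕ → Set
    ReflectsTo i j = 1 ≤ j × j ≤ r × IsColumnGap j (reflectionOf i)

    reflectsTo-column : ∀ {i} → 1 ≤ i → i ≤ r → ∃ (ReflectsTo i)
    reflectsTo-column 1≤i i≤r = column g , 1≤column g , column≤rank g reflectionOf<m , gap-isColumnGap g
      where
      open Row 1≤i i≤r
      g = gap reflection∉β

    reflectsTo-increasing : ∀ {i i′ j j′} → 1 ≤ i → i < i′ → i′ ≤ r → ReflectsTo i j → ReflectsTo i′ j′ → j < j′
    reflectsTo-increasing {i} {i′} 1≤i i<i′ i′≤r (_ , _ , gapⱼ) (1≤j′ , _ , gapⱼ′) =
      columnGap-increasing 1≤j′ gapⱼ gapⱼ′ (+-cancelˡ-< (β i′ + suc z) _ _ (begin-strict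
        β i′ + suc z + reflectionOf i  <⟨ +-monoˡ-< (reflectionOf i) (+-monoˡ-< (suc z) βᵢ′<βᵢ) ⟩
        β i + suc z + reflectionOf i   ≡⟨ swap (β i) (suc z) (reflectionOf i) ⟩
        β i + reflectionOf i + suc z   ≡⟨ Row.reflected 1≤i (≤-trans (<⇒≤ i<i′) i′≤r) ⟩
        m + m                          ≡⟨ Row.reflected 1≤i′ i′≤r ⟨
        β i′ + reflectionOf i′ + suc z ≡⟨ swap (β i′) (suc z) (reflectionOf i′) ⟨
        β i′ + suc z + reflectionOf i′ ∎))
      where
      open ≤-Reasoning
      1≤i′ = ≤-trans 1≤i (<⇒≤ i<i′)
      βᵢ′<βᵢ = β-strictlyDecreasing 1≤i i<i′ (proj₁ (≤rank⇒m≤β 1≤i′ i′≤r))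
      swap : ∀ a b c → a + b + c ≡ a + c + b
      swap = solve-∀

    conj≡part+z : ∀ {i} → 1 ≤ i → i ≤ r → conj λp i ≡ part λp i + z
    conj≡part+z {i} 1≤i i≤r =
      suc-injective (+-cancelˡ-≡ (reflectionOf i) (suc (conj λp i)) (suc (part λp i + z))
        (trans column-gap (sym reflected-gap)))
      where
      open Row 1≤i i≤r
      reflected-gap : reflectionOf i + suc (part λp i + z) ≡ m + i
      reflected-gap = to (reflection⇔columnGap (β+index i≤m)) reflected
      column-gap : IsColumnGap i (reflectionOf i)
      column-gap = subst (λ j → IsColumnGap j (reflectionOf i)) j≡i (proj₂ (proj₂ Rij))
        where
        j = proj₁ (reflectsTo-column 1≤i i≤r)
        Rij : ReflectsTo i j
        Rij = proj₂ (reflectsTo-column 1≤i i≤r)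
        j≡i : j ≡ i
        j≡i = increasingSelfCorrespondence-diagonal ReflectsTo r reflectsTo-column
                (λ (1≤j , j≤r , _) → 1≤j , j≤r) reflectsTo-increasing 1≤i i≤r Rij

module _ {t : ℕ} where

  ct≤r+kt⇒≤ : ∀ {c r k} → r < t → c * t ≤ r + k * t → c ≤ k
  ct≤r+kt⇒≤ {c} {r} {k} r<t ct≤ = ≤-pred (*-cancelʳ-< t c (suc k) (≤-<-trans ct≤ (+-monoˡ-< (k * t) r<t)))

  ct≤r+kt⇒≤1+ : ∀ {c r k} → r < t + t → c * t ≤ r + k * t → c ≤ suc k
  ct≤r+kt⇒≤1+ {c} {r} {k} r<2t ct≤ = ≤-pred (*-cancelʳ-< t c (suc (suc k))
    (≤-<-trans ct≤ (subst (r + k * t <_) (+-assoc t t (k * t)) (+-monoˡ-< (k * t) r<2t))))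

  r+kt<ct⇒< : ∀ {c r k} → r + k * t < c * t → k < c
  r+kt<ct⇒< {c} {r} {k} lt = *-cancelʳ-< t k c (≤-<-trans (m≤n+m (k * t) r) lt)

  ≤⇒ct≤r+kt : ∀ {c r k} → c ≤ k → c * t ≤ r + k * t
  ≤⇒ct≤r+kt {r = r} {k} c≤k = ≤-trans (*-monoˡ-≤ t c≤k) (m≤n+m (k * t) r)

private
  sum≡double-of-large : ∀ {n p q} → n < p →
    (∀ {k} → n ≤ k → k < p → k + q < n + n) → (∀ {k} → n ≤ k → k < n + n → p ≤ k → n + n ≤ k + q) →
    p + q ≡ n + n
  sum≡double-of-large {n} {suc p} {q} (s≤s n≤p) above below = ≤-antisym (above n≤p ≤-refl) 2n≤p+1+q
    where
    2n≤p+1+q : n + n ≤ suc p + q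
    2n≤p+1+q with suc p <? n + n
    ... | yes p+1<2n = below (m≤n⇒m≤1+n n≤p) p+1<2n ≤-refl
    ... | no  p+1≮2n = ≤-trans (≮⇒≥ p+1≮2n) (m≤m+n (suc p) q)

-- In use p and q count two paired runners: a bead at level k ≥ n on one forces the other to stop below
-- level 2n − 1 − k, a gap there forces it to reach that level.
sum≡double : ∀ {n p q} → 1 ≤ n →
  (∀ {k} → n ≤ k → k < p → k + q < n + n) → (∀ {k} → n ≤ k → k < n + n → p ≤ k → n + n ≤ k + q) →
  (∀ {k} → n ≤ k → k < q → k + p < n + n) → (∀ {k} → n ≤ k → k < n + n → q ≤ k → n + n ≤ k + p) →
  p + q ≡ n + n
sum≡double {n} {p} {q} 1≤n p-above p-below q-above q-below with n <? p | n <? q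
... | yes n<p | _       = sum≡double-of-large n<p p-above p-below
... | no  _   | yes n<q = trans (+-comm p q) (sum≡double-of-large n<q q-above q-below)
... | no  n≮p | no  n≮q = cong₂ _+_ (≤-antisym p≤n n≤p) (≤-antisym q≤n n≤q)
  where
  p≤n = ≮⇒≥ n≮p
  q≤n = ≮⇒≥ n≮q
  n<2n : n < n + n
  n<2n = subst (_≤ n + n) (+-comm n 1) (+-monoʳ-≤ n 1≤n)
  n≤p = +-cancelˡ-≤ n n p (q-below ≤-refl n<2n q≤n)
  n≤q = +-cancelˡ-≤ n n q (p-below ≤-refl n<2n p≤n)

module Counting (λp : Partition) (t n z : ℕ) .{{_ : NonZero t}} (1≤n : 1 ≤ n) (z+2≤t : z + 2 ≤ t)
                (core : IsTCore t λp) (ℓ≤tn : len λp ≤ t * n) where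

  z≤tn : z ≤ t * n
  z≤tn = ≤-trans (≤-trans (m≤m+n z 2) z+2≤t) (m≤m*n t n {{>-nonZero 1≤n}})

  open BetaSet λp (t * n) ℓ≤tn
  open Reflection λp (t * n) ℓ≤tn z z≤tn

  N : ℕ → ℕ
  N = nCount t λp (t * n)

  T : ℕ
  T = t ∸ z ∸ 1

  T+z+1≡t : T + suc z ≡ t
  T+z+1≡t = trans (cong (_+ suc z) (trans (∸-+-assoc t z 1) (cong (t ∸_) (+-comm z 1))))
                  (m∸n+n≡m (≤-trans (n≤1+n (suc z)) (subst (_≤ t) (+-comm z 2) z+2≤t)))

  T<t : T < t
  T<t = subst (T <_) T+z+1≡t (m<m+n T (s≤s z≤n))

  T+1≡t∸z : suc T ≡ t ∸ z
  T+1≡t∸z = +-cancelʳ-≡ z (suc T) (t ∸ z)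
    (trans (sym (+-suc T z)) (trans T+z+1≡t (sym (m∸n+n≡m (≤-trans (m≤m+n z 2) z+2≤t)))))

  ≤t∸1⇒<t : ∀ {i} → i ≤ t ∸ 1 → i < t
  ≤t∸1⇒<t {i} i≤t∸1 = m≤pred[n]⇒suc[m]≤n (subst (i ≤_) (sym (pred[m∸n]≡m∸[1+n] t 0)) i≤t∸1)

  <t⇒≤t∸1 : ∀ {i} → i < t → i ≤ t ∸ 1
  <t⇒≤t∸1 {i} i<t = subst (i ≤_) (pred[m∸n]≡m∸[1+n] t 0) (suc[m]≤n⇒m≤pred[n] i<t)

  t∸z≤⇒t≤+z : ∀ {i} → t ∸ z ≤ i → t ≤ i + z
  t∸z≤⇒t≤+z t∸z≤i = subst (_≤ _ + z) (m∸n+n≡m (≤-trans (m≤m+n z 2) z+2≤t)) (+-monoˡ-≤ z t∸z≤i)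

  t≤+z⇒t∸z≤ : ∀ {i} → t ≤ i + z → t ∸ z ≤ i
  t≤+z⇒t∸z≤ {i} t≤i+z = subst (t ∸ z ≤_) (m+n∸n≡m i z) (∸-monoˡ-≤ z t≤i+z)

  highResidues⇒t≤+z : ∀ {a b} → a + b + suc z ≡ t + t → b < t → t ≤ a + z
  highResidues⇒t≤+z {a} {b} a+b+z+1≡2t b<t = +-cancelʳ-≤ t t (a + z) (begin
    t + t           ≡⟨ a+b+z+1≡2t ⟨
    a + b + suc z   ≡⟨ regroup a b z ⟩
    a + z + suc b   ≤⟨ +-monoʳ-≤ (a + z) b<t ⟩
    a + z + t       ∎)
    where
    open ≤-Reasoning
    regroup : ∀ a b z → a + b + suc z ≡ a + z + suc b
    regroup = solve-∀

  PairCounts HighCounts : Set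
  PairCounts = ∀ i → i ≤ T → N i + N (T ∸ i) ≡ 2 * n
  HighCounts = ∀ i → t ∸ z ≤ i → i ≤ t ∸ 1 → N i ≡ n

  bead⇒<N : ∀ {a k} → a < t → InBeta (a + k * t) → k < N a
  bead⇒<N a<t = to (inBeta⇔<nCount t core a<t _)

  <N⇒bead : ∀ {a k} → a < t → k < N a → InBeta (a + k * t)
  <N⇒bead a<t = from (inBeta⇔<nCount t core a<t _)

  runner-decomposition : ∀ x → ∃[ a ] ∃[ k ] a < t × x ≡ a + k * t
  runner-decomposition x = x % t , x / t , m%n<n x t , m≡m%n+[m/n]*n x t

  tn≡nt : t * n ≡ n * t
  tn≡nt = *-comm t n

  2tn≡[n+n]t : t * n + t * n ≡ (n + n) * t
  2tn≡[n+n]t = trans (cong₂ _+_ tn≡nt tn≡nt) (sym (*-distribʳ-+ t n n))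

  tn≤a+kt : ∀ a {k} → n ≤ k → t * n ≤ a + k * t
  tn≤a+kt a {k} n≤k = subst (_≤ a + k * t) (sym tn≡nt) (≤⇒ct≤r+kt n≤k)

  levels-reflect : ∀ a b k k′ {w} → a + b + suc z ≡ w * t → w + (k + k′) ≡ n + n →
                   (a + k * t) + (b + k′ * t) + suc z ≡ t * n + t * n
  levels-reflect a b k k′ {w} residues levels = begin
    (a + k * t) + (b + k′ * t) + suc z   ≡⟨ regroup a b k k′ z t ⟩
    (a + b + suc z) + (k + k′) * t       ≡⟨ cong (_+ (k + k′) * t) residues ⟩
    w * t + (k + k′) * t                 ≡⟨ *-distribʳ-+ t w (k + k′) ⟨
    (w + (k + k′)) * t                   ≡⟨ cong (_* t) levels ⟩
    (n + n) * t                          ≡⟨ double t n ⟩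
    t * n + t * n                        ∎
    where
    open ≡-Reasoning
    regroup : ∀ a b k k′ z t → (a + k * t) + (b + k′ * t) + suc z ≡ (a + b + suc z) + (k + k′) * t
    regroup = solve-∀
    double : ∀ t n → (n + n) * t ≡ t * n + t * n
    double = solve-∀

  module _ (reflective : Reflective) where
    open Reflective reflective

    module RunnerPair {a b w} (a<t : a < t) (b<t : b < t) (residues : a + b + suc z ≡ w * t) where

      private
        partner : ℕ → ℕ
        partner k = n + n ∸ (w + k)

        partner-levels : ∀ {k} → w + k ≤ n + n → w + (k + partner k) ≡ n + n
        partner-levels {k} w+k≤2n = trans (sym (+-assoc w k (partner k))) (m+[n∸m]≡n w+k≤2n)

        reflects-to-partner : ∀ {k} → w + k ≤ n + n → (a + k * t) + (b + partner k * t) + suc z ≡ t * n + t * n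
        reflects-to-partner {k} w+k≤2n = levels-reflect a b k (partner k) {w} residues (partner-levels w+k≤2n)

      bead⇒partnerCount≤ : ∀ {k} → n ≤ k → k < N a → w + (k + N b) ≤ n + n
      bead⇒partnerCount≤ {k} n≤k k<Nₐ with w + k ≤? n + n
      ... | no w+k≰2n = ⊥-elim (noHighBead high (<N⇒bead a<t k<Nₐ))
        where
        open ≤-Reasoning
        high : t * n + t * n ≤ a + k * t + z
        high = +-cancelʳ-≤ t _ _ (begin
          t * n + t * n + t       ≡⟨ regroup t n ⟩
          suc (n + n) * t         ≤⟨ *-monoˡ-≤ t (≰⇒> w+k≰2n) ⟩
          (w + k) * t             ≡⟨ *-distribʳ-+ t w k ⟩
          w * t + k * t           ≡⟨ cong (_+ k * t) residues ⟨
          (a + b + suc z) + k * t ≡⟨ regroup′ a b z k t ⟩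
          (a + k * t + z) + suc b ≤⟨ +-monoʳ-≤ (a + k * t + z) b<t ⟩
          (a + k * t + z) + t     ∎)
          where
          regroup : ∀ t n → t * n + t * n + t ≡ suc (n + n) * t
          regroup = solve-∀
          regroup′ : ∀ a b z k t → (a + b + suc z) + k * t ≡ (a + k * t + z) + suc b
          regroup′ = solve-∀
      ... | yes w+k≤2n with N b ≤? partner k
      ...   | yes Nᵦ≤k′ = subst (w + (k + N b) ≤_) (partner-levels w+k≤2n)
                           (+-monoʳ-≤ w (+-monoʳ-≤ k Nᵦ≤k′))
      ...   | no  Nᵦ≰k′ = ⊥-elim (noBeadPair (reflects-to-partner w+k≤2n) (tn≤a+kt a n≤k)
                           (<N⇒bead a<t k<Nₐ) (<N⇒bead b<t (≰⇒> Nᵦ≰k′)))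

      gap⇒partnerCount> : ∀ {k} → n ≤ k → w + k ≤ n + n → N a ≤ k → n + n < w + (k + N b)
      gap⇒partnerCount> {k} n≤k w+k≤2n Nₐ≤k with N b ≤? partner k
      ... | yes Nᵦ≤k′ = ⊥-elim (noGapPair (reflects-to-partner w+k≤2n) (tn≤a+kt a n≤k)
                          (λ x∈β → <⇒≱ (bead⇒<N a<t x∈β) Nₐ≤k) (λ y∈β → <⇒≱ (bead⇒<N b<t y∈β) Nᵦ≤k′))
      ... | no  Nᵦ≰k′ = subst (_< w + (k + N b)) (partner-levels w+k≤2n)
                          (+-monoʳ-< w (+-monoʳ-< k (≰⇒> Nᵦ≰k′)))

    highCount≥n : ∀ {a} → a < t → t ≤ a + z → n ≤ N a
    highCount≥n {a} a<t t≤a+z = fromDec (inBeta? y)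
      where
      n′ = pred n
      n′+1≡n : suc n′ ≡ n
      n′+1≡n = suc-pred n {{>-nonZero 1≤n}}
      y = a + n′ * t
      tn≡t+n′t : t * n ≡ t + n′ * t
      tn≡t+n′t = trans (*-comm t n) (cong (_* t) (sym n′+1≡n))
      y<tn : y < t * n
      y<tn = subst (y <_) (sym tn≡t+n′t) (+-monoˡ-< (n′ * t) a<t)
      tn≤y+z : t * n ≤ y + z
      tn≤y+z = subst₂ _≤_ (sym tn≡t+n′t) (regroup a z n′ t) (+-monoˡ-≤ (n′ * t) t≤a+z)
        where
        regroup : ∀ a z n t → (a + z) + n * t ≡ a + n * t + z
        regroup = solve-∀
      fromDec : Dec (InBeta y) → n ≤ N a
      fromDec (yes y∈β) = subst (_≤ N a) n′+1≡n (bead⇒<N a<t y∈β)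
      fromDec (no  y∉β) = ⊥-elim (noLowGap tn≤y+z y<tn y∉β)

    reflective⇒pairCounts : PairCounts
    reflective⇒pairCounts i i≤T = trans (sum≡double 1≤n
        A.bead⇒partnerCount≤ (λ n≤k k<2n Nᵢ≤k → ≤-pred (A.gap⇒partnerCount> n≤k k<2n Nᵢ≤k))
        B.bead⇒partnerCount≤ (λ n≤k k<2n Nⱼ≤k → ≤-pred (B.gap⇒partnerCount> n≤k k<2n Nⱼ≤k)))
      (cong (n +_) (sym (+-identityʳ n)))
      where
      j = T ∸ i
      i<t = ≤-<-trans i≤T T<t
      j<t = ≤-<-trans (m∸n≤m T i) T<t
      i+j+z+1≡t : i + j + suc z ≡ 1 * t
      i+j+z+1≡t = trans (cong (_+ suc z) (m+[n∸m]≡n i≤T)) (trans T+z+1≡t (sym (*-identityˡ t)))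
      module A = RunnerPair {w = 1} i<t j<t i+j+z+1≡t
      module B = RunnerPair {w = 1} j<t i<t (trans (cong (_+ suc z) (+-comm j i)) i+j+z+1≡t)

    reflective⇒highCounts : HighCounts
    reflective⇒highCounts i t∸z≤i i≤t∸1 = ≤-antisym Nᵢ≤n (highCount≥n i<t (t∸z≤⇒t≤+z t∸z≤i))
      where
      i<t = ≤t∸1⇒<t i≤t∸1
      j = t + T ∸ i
      i+j≡t+T : i + j ≡ t + T
      i+j≡t+T = m+[n∸m]≡n (≤-trans (<⇒≤ i<t) (m≤m+n t T))
      i+j+z+1≡2t : i + j + suc z ≡ t + t
      i+j+z+1≡2t = trans (cong (_+ suc z) i+j≡t+T) (trans (+-assoc t T (suc z)) (cong (t +_) T+z+1≡t))
      j<t : j < t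
      j<t = +-cancelˡ-< i j t (begin-strict
        i + j       ≡⟨ i+j≡t+T ⟩
        t + T       <⟨ +-monoʳ-< t (subst (_≤ i) (sym T+1≡t∸z) t∸z≤i) ⟩
        t + i       ≡⟨ +-comm t i ⟩
        i + t       ∎)
        where open ≤-Reasoning
      Nᵢ≤n : N i ≤ n
      Nᵢ≤n with N i ≤? n
      ... | yes Nᵢ≤n = Nᵢ≤n
      ... | no  Nᵢ≰n = ⊥-elim (<-irrefl refl (<-≤-trans (m<n+m (n + n) {2} (s≤s z≤n)) (begin
        2 + (n + n)     ≤⟨ +-monoʳ-≤ 2 (+-monoʳ-≤ n (highCount≥n j<t (highResidues⇒t≤+z j+i+z+1≡2t i<t))) ⟩
        2 + (n + N j)   ≤⟨ RunnerPair.bead⇒partnerCount≤ {w = 2} i<t j<t i+j+z+1≡2t′ ≤-refl (≰⇒> Nᵢ≰n) ⟩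
        n + n           ∎)))
        where
        open ≤-Reasoning
        i+j+z+1≡2t′ : i + j + suc z ≡ 2 * t
        i+j+z+1≡2t′ = trans i+j+z+1≡2t (cong (t +_) (sym (+-identityʳ t)))
        j+i+z+1≡2t : j + i + suc z ≡ t + t
        j+i+z+1≡2t = trans (cong (_+ suc z) (+-comm j i)) i+j+z+1≡2t

  module _ (pairCounts : PairCounts) (highCounts : HighCounts) where

    highCount : ∀ {a} → a < t → t ≤ a + z → N a ≡ n
    highCount a<t t≤a+z = highCounts _ (t≤+z⇒t∸z≤ t≤a+z) (<t⇒≤t∸1 a<t)

    data RunnerPairing (a b K : ℕ) : Set where
      complementary : N a + N b ≡ n + n → suc K ≡ n + n → RunnerPairing a b K
      bothHigh      : N a ≡ n → N b ≡ n → suc (suc K) ≡ n + n → RunnerPairing a b K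

    -- a + b + z + 1 is either t (so b = T ∸ a) or t + t (so both runners lie in t ∸ z … t ∸ 1).
    pairing : ∀ {a b} k k′ → a < t → b < t →
              (a + k * t) + (b + k′ * t) + suc z ≡ t * n + t * n → RunnerPairing a b (k + k′)
    pairing {a} {b} k k′ a<t b<t reflected = classify (n + n ∸ K) refl
      where
      open ≡-Reasoning
      K = k + k′
      s = a + b + suc z

      s≡[2n∸K]t : s ≡ (n + n ∸ K) * t
      s≡[2n∸K]t = begin
        s                        ≡⟨ m+n∸n≡m s (K * t) ⟨
        s + K * t ∸ K * t        ≡⟨ cong (_∸ K * t) s+Kt≡2nt ⟩
        (n + n) * t ∸ K * t      ≡⟨ *-distribʳ-∸ t (n + n) K ⟨
        (n + n ∸ K) * t          ∎
        where
        regroup : ∀ a b k k′ z t → (a + b + suc z) + (k + k′) * t ≡ (a + k * t) + (b + k′ * t) + suc z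
        regroup = solve-∀
        double : ∀ t n → t * n + t * n ≡ (n + n) * t
        double = solve-∀
        s+Kt≡2nt = trans (regroup a b k k′ z t) (trans reflected (double t n))

      K+w≡2n : ∀ {w} → n + n ∸ K ≡ suc w → K + suc w ≡ n + n
      K+w≡2n {w} eq with K ≤? n + n
      ... | yes K≤2n = trans (cong (K +_) (sym eq)) (m+[n∸m]≡n K≤2n)
      ... | no  K≰2n = ⊥-elim (0≢1+n (trans (sym (m≤n⇒m∸n≡0 (<⇒≤ (≰⇒> K≰2n)))) eq))

      classify : ∀ w → n + n ∸ K ≡ w → RunnerPairing a b K
      classify zero eq = ⊥-elim (0≢1+n (trans (sym (trans s≡[2n∸K]t (cong (_* t) eq))) (+-suc (a + b) z)))
      classify (suc zero) eq = complementary Nₐ+Nᵦ≡2n (trans (+-comm 1 K) (K+w≡2n eq))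
        where
        a+b≡T : a + b ≡ T
        a+b≡T = +-cancelʳ-≡ (suc z) _ _
          (trans s≡[2n∸K]t (trans (cong (_* t) eq) (trans (+-identityʳ t) (sym T+z+1≡t))))
        b≡T∸a : b ≡ T ∸ a
        b≡T∸a = trans (sym (m+n∸m≡n a b)) (cong (_∸ a) a+b≡T)
        Nₐ+Nᵦ≡2n : N a + N b ≡ n + n
        Nₐ+Nᵦ≡2n = trans (cong (λ j → N a + N j) b≡T∸a)
          (trans (pairCounts a (subst (a ≤_) a+b≡T (m≤m+n a b))) (cong (n +_) (+-identityʳ n)))
      classify (suc (suc zero)) eq = bothHigh
        (highCount a<t (highResidues⇒t≤+z s≡2t b<t))
        (highCount b<t (highResidues⇒t≤+z (trans (cong (_+ suc z) (+-comm b a)) s≡2t) a<t))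
        (trans (+-comm 2 K) (K+w≡2n eq))
        where
        s≡2t : s ≡ t + t
        s≡2t = trans s≡[2n∸K]t (trans (cong (_* t) eq) (cong (t +_) (+-identityʳ t)))
      classify (suc (suc (suc w))) eq = ⊥-elim (<⇒≱ s<3t 3t≤s)
        where
        s<3t : s < t + t + t
        s<3t = +-mono-< (+-mono-< a<t b<t) (subst (_≤ t) (+-comm z 2) z+2≤t)
        3t≤s : t + t + t ≤ s
        3t≤s = subst (t + t + t ≤_) (sym (trans s≡[2n∸K]t (cong (_* t) eq)))
          (≤-trans (≤-reflexive (+-assoc t t t)) (+-monoʳ-≤ t (+-monoʳ-≤ t (m≤m+n t (w * t)))))

    private
      gap⇒N≤ : ∀ {a} k → a < t → ¬ InBeta (a + k * t) → N a ≤ k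
      gap⇒N≤ k a<t gap = ≮⇒≥ (λ k<Nₐ → gap (<N⇒bead a<t k<Nₐ))

      tn≤a+kt⇒n≤k : ∀ {a} k → a < t → t * n ≤ a + k * t → n ≤ k
      tn≤a+kt⇒n≤k {a} k a<t tn≤ = ct≤r+kt⇒≤ a<t (subst (_≤ a + k * t) tn≡nt tn≤)

    counts⇒noBeadPair : ∀ {x y} → x + y + suc z ≡ t * n + t * n → t * n ≤ x → InBeta x → InBeta y → ⊥
    counts⇒noBeadPair {x} {y} reflected tn≤x x∈β y∈β with runner-decomposition x | runner-decomposition y
    ... | a , k , a<t , refl | b , k′ , b<t , refl with pairing k k′ a<t b<t reflected
    ...   | complementary Nₐ+Nᵦ≡2n K+1≡2n = 1+n≰n (begin
      suc (suc (k + k′))  ≡⟨ cong suc (+-suc k k′) ⟨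
      suc k + suc k′      ≤⟨ +-mono-≤ (bead⇒<N a<t x∈β) (bead⇒<N b<t y∈β) ⟩
      N a + N b           ≡⟨ trans Nₐ+Nᵦ≡2n (sym K+1≡2n) ⟩
      suc (k + k′)        ∎)
      where open ≤-Reasoning
    ...   | bothHigh Nₐ≡n _ _ = <⇒≱ (subst (k <_) Nₐ≡n (bead⇒<N a<t x∈β)) (tn≤a+kt⇒n≤k k a<t tn≤x)

    counts⇒noGapPair : ∀ {x y} → x + y + suc z ≡ t * n + t * n → t * n ≤ x → ¬ InBeta x → ¬ InBeta y → ⊥
    counts⇒noGapPair {x} {y} reflected tn≤x x∉β y∉β with runner-decomposition x | runner-decomposition y
    ... | a , k , a<t , refl | b , k′ , b<t , refl with pairing k k′ a<t b<t reflected
    ...   | complementary Nₐ+Nᵦ≡2n K+1≡2n = 1+n≰n (begin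
      suc (k + k′)        ≡⟨ trans K+1≡2n (sym Nₐ+Nᵦ≡2n) ⟩
      N a + N b           ≤⟨ +-mono-≤ (gap⇒N≤ k a<t x∉β) (gap⇒N≤ k′ b<t y∉β) ⟩
      k + k′              ∎)
      where open ≤-Reasoning
    ...   | bothHigh _ Nᵦ≡n K+2≡2n = 1+n≰n (≤-trans (n≤1+n _) (begin
      suc (suc (k + k′))  ≡⟨ K+2≡2n ⟩
      n + n               ≤⟨ +-mono-≤ (tn≤a+kt⇒n≤k k a<t tn≤x) (subst (_≤ k′) Nᵦ≡n (gap⇒N≤ k′ b<t y∉β)) ⟩
      k + k′              ∎))
      where open ≤-Reasoning

    private
      a+z<2t : ∀ {a} → a < t → a + z < t + t
      a+z<2t a<t = +-mono-< a<t (≤-trans (n≤1+n (suc z)) (subst (_≤ t) (+-comm z 2) z+2≤t))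

      shift-z : ∀ {c} a k → c ≤ a + k * t + z → c ≤ (a + z) + k * t
      shift-z {c} a k = subst (c ≤_) (regroup a k t z)
        where
        regroup : ∀ a k t z → a + k * t + z ≡ (a + z) + k * t
        regroup = solve-∀

    counts⇒noHighBead : ∀ {x} → t * n + t * n ≤ x + z → InBeta x → ⊥
    counts⇒noHighBead {x} 2tn≤x+z x∈β with runner-decomposition x
    ... | a , k , a<t , refl = byRunner (a ≤? T)
      where
      k<Nₐ = bead⇒<N a<t x∈β
      2nt≤a+z+kt : (n + n) * t ≤ (a + z) + k * t
      2nt≤a+z+kt = shift-z a k (subst (_≤ a + k * t + z) 2tn≡[n+n]t 2tn≤x+z)
      byRunner : Dec (a ≤ T) → ⊥
      byRunner (yes a≤T) = <⇒≱ (<-≤-trans k<Nₐ Nₐ≤2n) (ct≤r+kt⇒≤ a+z<t 2nt≤a+z+kt)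
        where
        a+z<t : a + z < t
        a+z<t = subst (a + z <_) T+z+1≡t (subst (_≤ T + suc z) (+-suc a z) (+-monoˡ-≤ (suc z) a≤T))
        Nₐ≤2n : N a ≤ n + n
        Nₐ≤2n = ≤-trans (m≤m+n (N a) _) (≤-reflexive (trans (pairCounts a a≤T) (cong (n +_) (+-identityʳ n))))
      byRunner (no a≰T) = <-irrefl refl (<-≤-trans (m<m+n n 1≤n) n+n≤n)
        where
        Nₐ≡n : N a ≡ n
        Nₐ≡n = highCounts a (subst (_≤ a) T+1≡t∸z (≰⇒> a≰T)) (<t⇒≤t∸1 a<t)
        n+n≤n : n + n ≤ n
        n+n≤n = ≤-trans (ct≤r+kt⇒≤1+ (a+z<2t a<t) 2nt≤a+z+kt) (subst (suc k ≤_) Nₐ≡n k<Nₐ)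

    counts⇒noLowGap : ∀ {y} → t * n ≤ y + z → y < t * n → ¬ InBeta y → ⊥
    counts⇒noLowGap {y} tn≤y+z y<tn y∉β with runner-decomposition y
    ... | a , k , a<t , refl = y∉β (<N⇒bead a<t (subst (k <_) (sym Nₐ≡n) k<n))
      where
      k<n : k < n
      k<n = r+kt<ct⇒< (subst (a + k * t <_) tn≡nt y<tn)
      nt≤a+z+kt : n * t ≤ (a + z) + k * t
      nt≤a+z+kt = shift-z a k (subst (_≤ a + k * t + z) tn≡nt tn≤y+z)
      n≡k+1 : n ≡ suc k
      n≡k+1 = ≤-antisym (ct≤r+kt⇒≤1+ (a+z<2t a<t) nt≤a+z+kt) k<n
      Nₐ≡n : N a ≡ n
      Nₐ≡n = highCount a<t (+-cancelʳ-≤ (k * t) t (a + z)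
        (subst (_≤ (a + z) + k * t) (cong (_* t) n≡k+1) nt≤a+z+kt))

    counts⇒reflective : Reflective
    counts⇒reflective = record
      { noBeadPair = counts⇒noBeadPair
      ; noGapPair  = counts⇒noGapPair
      ; noHighBead = counts⇒noHighBead
      ; noLowGap   = counts⇒noLowGap
      }

lemma3p6 : (t : ℕ) .{{_ : NonZero t}} → (n z : ℕ) → (λp : Partition) →
    2 ≤ t → 1 ≤ n → z + 2 ≤ t → IsTCore t λp → len λp ≤ t * n →
    IsZAsymmetric z λp ⇔
      ((∀ i → i ≤ t ∸ z ∸ 1 →
          nCount t λp (t * n) i + nCount t λp (t * n) (t ∸ z ∸ 1 ∸ i) ≡ 2 * n)
       × (∀ i → t ∸ z ≤ i → i ≤ t ∸ 1 → nCount t λp (t * n) i ≡ n))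
-- The hypothesis 2 ≤ t is implied by z + 2 ≤ t.
lemma3p6 t n z λp _ 1≤n z+2≤t core ℓ≤tn = mk⇔
  (λ zAsym → let reflective = zAsym⇒reflective zAsym in
     reflective⇒pairCounts reflective , reflective⇒highCounts reflective)
  (λ (pairCounts , highCounts) → reflective⇒zAsym (counts⇒reflective pairCounts highCounts))
  where
  open Counting λp t n z 1≤n z+2≤t core ℓ≤tn
  open Reflection λp (t * n) ℓ≤tn z z≤tn
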